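{- Let $G$ be a finite simple graph and $G_1,\dots,G_k$ its connected components. Then $\sigma^*(G)\leq \min\{\sigma^*(G_i): i\in[k]\}$.
   Context: An independent set $I$ of a graph $H$ means a nonempty set of pairwise non-adjacent vertices; $\delta_H(I)=\min\{d_H(u):u\in I\}$, $w_H(I)=\sum_{u\in I}d_H(u)$; $I$ is large if $|I|\ge\delta_H(I)+1$. $\sigma^*(H)=\min\{w_H(I): I\text{ a large independent set of }H\}$, or $+\infty$ if none exists. -}

module Defs where

open import Data.Bool using (Bool; true; false; not; _∧_; if_then_else_)
open import Data.Nat using (ℕ; zero; suc; _+_; _≤_; _≤ᵇ_; _⊓_)
open import Data.Fin using (Fin)
open import Data.List using (List; []; _∷_; map; filter; length; concatMap; foldr)
open import Data.Bool.ListAction using (and)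
open import Data.Nat.ListAction using (sum)
open import Data.List using (allFin)
open import Data.Vec using (Vec; []; _∷_; lookup)
open import Data.Maybe using (Maybe; just; nothing)
open import Data.Product using (Σ; ∃; _×_; _,_)
open import Data.Unit using (⊤)
open import Data.Empty using (⊥)
open import Function using (Injective)
open import Relation.Binary.PropositionalEquality using (_≡_)
open import Relation.Nullary using (¬_)
open import Relation.Unary using (Pred)

record Graph : Set where
  field
    n     : ℕ
    adj   : Fin n → Fin n → Bool
    sym   : ∀ u v → adj u v ≡ adj v u
    irr   : ∀ u → adj u u ≡ false
open Graph public

deg : (H : Graph) → Fin (n H) → ℕ
deg H u = length (filter (λ v → adj H u v Data.Bool.≟ true) (allFin (n H)))

VSet : Graph → Set
VSet H = Vec Bool (n H)

members : (H : Graph) → VSet H → List (Fin (n H))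
members H I = filter (λ v → lookup I v Data.Bool.≟ true) (allFin (n H))

allSubsets : (m : ℕ) → List (Vec Bool m)
allSubsets zero    = [] ∷ []
allSubsets (suc m) = concatMap (λ s → (false ∷ s) ∷ (true ∷ s) ∷ []) (allSubsets m)

-- minimum of a list of naturals, the list assumed nonempty (0 for [])
minList : List ℕ → ℕ
minList []       = 0
minList (x ∷ xs) = foldr _⊓_ x xs

isIndep : (H : Graph) → VSet H → Bool
isIndep H I with members H I
... | []     = false
... | x ∷ xs = and (concatMap (λ u → map (λ v → not (adj H u v)) (x ∷ xs)) (x ∷ xs))

δ : (H : Graph) → VSet H → ℕ
δ H I = minList (map (deg H) (members H I))

w : (H : Graph) → VSet H → ℕ
w H I = sum (map (deg H) (members H I))

isLargeIndep : (H : Graph) → VSet H → Bool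
isLargeIndep H I = isIndep H I ∧ (suc (δ H I) ≤ᵇ length (members H I))

-- σ*(H) as an element of ℕ ∪ {+∞}; nothing = +∞
minMaybe : List ℕ → Maybe ℕ
minMaybe []       = nothing
minMaybe (x ∷ xs) = just (foldr _⊓_ x xs)

σ* : Graph → Maybe ℕ
σ* H = minMaybe (map (w H) (filter (λ I → isLargeIndep H I Data.Bool.≟ true) (allSubsets (n H))))

_≤∞_ : Maybe ℕ → Maybe ℕ → Set
just a  ≤∞ just b  = a ≤ b
_       ≤∞ nothing = ⊤
nothing ≤∞ just _  = ⊥

data Reachable (G : Graph) : Fin (n G) → Fin (n G) → Set where
  here : ∀ {u} → Reachable G u u
  step : ∀ {u v x} → adj G u v ≡ true → Reachable G v x → Reachable G u x

induced : (G : Graph) (m : ℕ) (f : Fin m → Fin (n G)) → Injective _≡_ _≡_ f → Graph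
induced G m f _ = record
  { n = m ; adj = λ i j → adj G (f i) (f j)
  ; sym = λ i j → sym G (f i) (f j) ; irr = λ i → irr G (f i) }

-- the image of f is a connected component of G: it is exactly the set of
-- vertices reachable from some vertex v
IsComponent : (G : Graph) (m : ℕ) (f : Fin m → Fin (n G)) → Set
IsComponent G m f = Σ (Fin (n G)) λ v → ∀ u →
  ((Σ (Fin m) λ i → f i ≡ u) → Reachable G v u) × (Reachable G v u → Σ (Fin m) λ i → f i ≡ u)

{-# OPTIONS --safe #-}
module Submission where

-- A connected component H is closed under taking neighbours in G, so every vertex of H
-- has the same degree in H as in G. Hence the image in G of a large independent set I
-- of H is again independent, with the same size, the same minimum degree and the same
-- weight; so every value over which σ*(H) minimises also occurs for σ*(G).

open import Defs
open import Data.Bool using (Bool; true; false; not; T)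
import Data.Bool as Bool
open import Data.Bool.ListAction using (and)
open import Data.Bool.Properties using (T-∧; T-≡)
open import Data.Fin using (Fin)
import Data.Fin as Fin
open import Data.Fin.Properties using (any?)
open import Data.List using (List; []; _∷_; map; filter; length; concatMap; foldr; allFin)
open import Data.List.Membership.Propositional using (_∈_)
open import Data.List.Membership.Propositional.Properties
  using (∈-filter⁺; ∈-filter⁻; ∈-allFin; ∈-map⁺; ∈-map⁻; ∈-concatMap⁺; foldr-selective)
open import Data.List.Membership.Propositional.Properties.WithK using (unique∧set⇒bag)
open import Data.List.Properties using (foldr-preservesᵒ; length-map; map-id; map-∘; map-cong)
open import Data.List.Relation.Binary.BagAndSetEquality using (∼bag⇒↭)
open import Data.List.Relation.Binary.Permutation.Propositional using (_↭_; ↭-sym; ↭-trans; ↭-reflexive)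
open import Data.List.Relation.Binary.Permutation.Propositional.Properties
  using (↭-empty-inv; ¬x∷xs↭[]; ∈-resp-↭; All-resp-↭; ↭-length)
  renaming (map⁺ to ↭-map⁺)
open import Data.List.Relation.Binary.Subset.Propositional using (_⊆_)
open import Data.List.Relation.Unary.All as All using (All)
open import Data.List.Relation.Unary.All.Properties using (all⁺; all⁻; concat⁺; concat⁻)
  renaming (map⁺ to All-map⁺; map⁻ to All-map⁻)
import Data.List.Relation.Unary.Any as Any
open import Data.List.Relation.Unary.Any using (here; there)
import Data.List.Relation.Unary.Unique.Propositional.Properties as Unique
open import Data.Nat using (ℕ; zero; suc; _≤_; _<_; _⊓_; z<s)
open import Data.Nat.ListAction.Properties using (sum-↭)
open import Data.Nat.Properties
  using (≤-reflexive; <-≤-trans; ≤-antisym; ⊓-sel; m≤n⇒m⊓o≤n; m≤n⇒o⊓m≤n; ≤ᵇ⇒≤; ≤⇒≤ᵇ)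
open import Data.Product using (∃; _×_; _,_; proj₁; proj₂)
open import Data.Sum using ([_,_]; [_,_]′)
open import Data.Unit using (tt)
open import Data.Vec using (Vec; []; _∷_; tabulate; lookup)
open import Data.Vec.Properties using (lookup∘tabulate)
open import Function using (Injective; _∘_; id)
open import Function.Bundles using (_⇔_; mk⇔; Equivalence)
open import Level using (0ℓ)
open import Relation.Binary.PropositionalEquality
  using (_≡_; refl; trans; subst; subst₂; module ≡-Reasoning)
  renaming (sym to ≡-sym)
open import Relation.Nullary using (contradiction)
open import Relation.Nullary.Decidable using (Dec; yes; no; does; dec-true; _×-dec_)
open import Relation.Unary using (Pred; Decidable)

foldr-⊓-≤ : ∀ x xs {y} → y ∈ x ∷ xs → foldr _⊓_ x xs ≤ y
foldr-⊓-≤ x xs y∈ = foldr-preservesᵒ (λ a b → [ m≤n⇒m⊓o≤n b , m≤n⇒o⊓m≤n a ]) x xs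
                                     (Any.toSum (Any.map (≤-reflexive ∘ ≡-sym) y∈))

foldr-⊓-∈ : ∀ x xs → foldr _⊓_ x xs ∈ x ∷ xs
foldr-⊓-∈ x xs = [ here , there ]′ (foldr-selective ⊓-sel x xs)

foldr-⊓-mono-⊆ : ∀ {x xs y ys} → y ∷ ys ⊆ x ∷ xs → foldr _⊓_ x xs ≤ foldr _⊓_ y ys
foldr-⊓-mono-⊆ {x} {xs} {y} {ys} sub = foldr-⊓-≤ x xs (sub (foldr-⊓-∈ y ys))

minList-↭ : ∀ {xs ys} → xs ↭ ys → minList xs ≡ minList ys
minList-↭ {[]}     p rewrite ↭-empty-inv (↭-sym p) = refl
minList-↭ {_ ∷ _} {[]}    p = contradiction p ¬x∷xs↭[]
minList-↭ {_ ∷ _} {_ ∷ _} p =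
  ≤-antisym (foldr-⊓-mono-⊆ (∈-resp-↭ (↭-sym p))) (foldr-⊓-mono-⊆ (∈-resp-↭ p))

minMaybe-mono-⊆ : ∀ {xs ys} → ys ⊆ xs → minMaybe xs ≤∞ minMaybe ys
minMaybe-mono-⊆ {[]}    {[]}    _   = tt
minMaybe-mono-⊆ {_ ∷ _} {[]}    _   = tt
minMaybe-mono-⊆ {[]}    {_ ∷ _} sub with () ← sub (here refl)
minMaybe-mono-⊆ {_ ∷ _} {_ ∷ _} sub = foldr-⊓-mono-⊆ sub

T-and⇔All : ∀ bs → T (and bs) ⇔ All T bs
T-and⇔All bs = subst (λ cs → T (and cs) ⇔ All T bs) (map-id bs) (mk⇔ (all⁺ id bs) (all⁻ id))

module _ {A : Set} (a : A → A → Bool) where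

  PairwiseNonadjacent : List A → Set
  PairwiseNonadjacent L = All (λ u → All (λ v → T (not (a u v))) L) L

  T-and-nonadjacent⇔ : ∀ L →
    T (and (concatMap (λ u → map (λ v → not (a u v)) L) L)) ⇔ PairwiseNonadjacent L
  T-and-nonadjacent⇔ L = mk⇔
    (All.map All-map⁻ ∘ All-map⁻ ∘ concat⁻ ∘ Equivalence.to (T-and⇔All _))
    (Equivalence.from (T-and⇔All _) ∘ concat⁺ ∘ All-map⁺ ∘ All.map All-map⁺)

  PairwiseNonadjacent-↭ : ∀ {xs ys} → xs ↭ ys → PairwiseNonadjacent xs → PairwiseNonadjacent ys
  PairwiseNonadjacent-↭ p = All-resp-↭ p ∘ All.map (All-resp-↭ p)

PairwiseNonadjacent-map : ∀ {A B : Set} (a : A → A → Bool) (f : B → A) {L} →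
  PairwiseNonadjacent (λ u v → a (f u) (f v)) L → PairwiseNonadjacent a (map f L)
PairwiseNonadjacent-map a f = All-map⁺ ∘ All.map All-map⁺

isIndep⇔ : ∀ H I →
  T (isIndep H I) ⇔ (0 < length (members H I) × PairwiseNonadjacent (adj H) (members H I))
isIndep⇔ H I with members H I
... | []     = mk⇔ (λ ()) (λ ())
... | x ∷ xs = mk⇔ (λ t → z<s , to t) (from ∘ proj₂)
  where open Equivalence (T-and-nonadjacent⇔ (adj H) (x ∷ xs))

-- Nonemptiness, required by isIndep, is implied by δ H I < |I|.
IsLargeIndependent : (H : Graph) → VSet H → Set
IsLargeIndependent H I = PairwiseNonadjacent (adj H) (members H I) × δ H I < length (members H I)

isLargeIndep⇔ : ∀ H I → T (isLargeIndep H I) ⇔ IsLargeIndependent H I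
isLargeIndep⇔ H I = mk⇔ to from
  where
  to : T (isLargeIndep H I) → IsLargeIndependent H I
  to t with indep , large ← Equivalence.to T-∧ t =
    proj₂ (Equivalence.to (isIndep⇔ H I) indep) , ≤ᵇ⇒≤ _ _ large
  from : IsLargeIndependent H I → T (isLargeIndep H I)
  from (pw , δ<∣I∣) = Equivalence.from T-∧
    (Equivalence.from (isIndep⇔ H I) (<-≤-trans z<s δ<∣I∣ , pw) , ≤⇒≤ᵇ δ<∣I∣)

allSubsets-complete : ∀ k (v : Vec Bool k) → v ∈ allSubsets k
allSubsets-complete zero    []      = here refl
allSubsets-complete (suc k) (b ∷ v) =
  ∈-concatMap⁺ _ (Any.map (λ { refl → ∷-∈-extensions b }) (allSubsets-complete k v))
  where
  ∷-∈-extensions : ∀ b → (b ∷ v) ∈ (false ∷ v) ∷ (true ∷ v) ∷ []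
  ∷-∈-extensions false = here refl
  ∷-∈-extensions true  = there (here refl)

isLargeIndep? : (H : Graph) → Decidable (λ I → isLargeIndep H I ≡ true)
isLargeIndep? H I = isLargeIndep H I Bool.≟ true

largeWeights : Graph → List ℕ
largeWeights H = map (w H) (filter (isLargeIndep? H) (allSubsets (n H)))

∈-largeWeights⁺ : ∀ H I → T (isLargeIndep H I) → w H I ∈ largeWeights H
∈-largeWeights⁺ H I large =
  ∈-map⁺ (w H) (∈-filter⁺ (isLargeIndep? H) (allSubsets-complete (n H) I) (Equivalence.to T-≡ large))

∈-largeWeights⁻ : ∀ H {s} → s ∈ largeWeights H → ∃ λ I → T (isLargeIndep H I) × s ≡ w H I
∈-largeWeights⁻ H s∈ with I , I∈ , refl ← ∈-map⁻ (w H) s∈ =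
  I , Equivalence.from T-≡ (proj₂ (∈-filter⁻ (isLargeIndep? H) {xs = allSubsets (n H)} I∈)) , refl

module _ {m N : ℕ} (f : Fin m → Fin N) (f-inj : Injective _≡_ _≡_ f)
         {P : Pred (Fin m) 0ℓ} (P? : Decidable P) {Q : Pred (Fin N) 0ℓ} (Q? : Decidable Q)
         (Q⇒image : ∀ v → Q v → ∃ λ j → f j ≡ v × P j) (P⇒Q∘f : ∀ j → P j → Q (f j)) where

  filter-allFin-↭-image : filter Q? (allFin N) ↭ map f (filter P? (allFin m))
  filter-allFin-↭-image = ∼bag⇒↭ (unique∧set⇒bag
    (Unique.filter⁺ Q? (Unique.allFin⁺ N)) (Unique.map⁺ f-inj (Unique.filter⁺ P? (Unique.allFin⁺ m)))
    (mk⇔ to from))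
    where
    to : ∀ {v} → v ∈ filter Q? (allFin N) → v ∈ map f (filter P? (allFin m))
    to {v} v∈ with j , refl , Pj ← Q⇒image v (proj₂ (∈-filter⁻ Q? {xs = allFin N} v∈)) =
      ∈-map⁺ f (∈-filter⁺ P? (∈-allFin j) Pj)
    from : ∀ {v} → v ∈ map f (filter P? (allFin m)) → v ∈ filter Q? (allFin N)
    from v∈ with j , j∈ , refl ← ∈-map⁻ f v∈ =
      ∈-filter⁺ Q? (∈-allFin (f j)) (P⇒Q∘f j (proj₂ (∈-filter⁻ P? {xs = allFin m} j∈)))

Reachable-snoc : ∀ {G u v x} → Reachable G u v → adj G v x ≡ true → Reachable G u x
Reachable-snoc here       e = step e here
Reachable-snoc (step e r) e′ = step e (Reachable-snoc r e′)

NeighbourClosed : (G : Graph) {m : ℕ} → (Fin m → Fin (n G)) → Set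
NeighbourClosed G f = ∀ i v → adj G (f i) v ≡ true → ∃ λ j → f j ≡ v

IsComponent⇒NeighbourClosed : ∀ G m f → IsComponent G m f → NeighbourClosed G f
IsComponent⇒NeighbourClosed G m f (_ , component) i v e =
  proj₂ (component v) (Reachable-snoc (proj₁ (component (f i)) (i , refl)) e)

module Induced (G : Graph) (m : ℕ) (f : Fin m → Fin (n G)) (f-inj : Injective _≡_ _≡_ f) where

  H : Graph
  H = induced G m f f-inj

  in-image? : (I : VSet H) (v : Fin (n G)) → Dec (∃ λ j → f j ≡ v × lookup I j ≡ true)
  in-image? I v = any? (λ j → (f j Fin.≟ v) ×-dec (lookup I j Bool.≟ true))

  image : VSet H → VSet G
  image I = tabulate (does ∘ in-image? I)

  members-image : ∀ I → members G (image I) ↭ map f (members H I)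
  members-image I = filter-allFin-↭-image f f-inj _ _ Q⇒image P⇒Q∘f
    where
    Q⇒image : ∀ v → lookup (image I) v ≡ true → ∃ λ j → f j ≡ v × lookup I j ≡ true
    Q⇒image v e with in-image? I v | lookup∘tabulate (does ∘ in-image? I) v
    ... | yes witness | _  = witness
    ... | no _        | eq = contradiction (trans (≡-sym eq) e) λ ()
    P⇒Q∘f : ∀ j → lookup I j ≡ true → lookup (image I) (f j) ≡ true
    P⇒Q∘f j e = trans (lookup∘tabulate (does ∘ in-image? I) (f j))
                      (dec-true (in-image? I (f j)) (j , refl , e))

  length-members-image : ∀ I → length (members G (image I)) ≡ length (members H I)
  length-members-image I = trans (↭-length (members-image I)) (length-map f (members H I))

  PairwiseNonadjacent-image : ∀ I →
    PairwiseNonadjacent (adj H) (members H I) → PairwiseNonadjacent (adj G) (members G (image I))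
  PairwiseNonadjacent-image I =
    PairwiseNonadjacent-↭ (adj G) (↭-sym (members-image I)) ∘ PairwiseNonadjacent-map (adj G) f

  module _ (closed : NeighbourClosed G f) where

    deg-induced : ∀ i → deg G (f i) ≡ deg H i
    deg-induced i = trans (↭-length (filter-allFin-↭-image f f-inj adjacent? _ Q⇒image λ _ e → e))
                          (length-map f (filter adjacent? (allFin m)))
      where
      adjacent? = λ j → adj H i j Bool.≟ true
      Q⇒image : ∀ v → adj G (f i) v ≡ true → ∃ λ j → f j ≡ v × adj G (f i) (f j) ≡ true
      Q⇒image v e with j , refl ← closed i v e = j , refl , e

    degrees-image : ∀ I → map (deg G) (members G (image I)) ↭ map (deg H) (members H I)
    degrees-image I = ↭-trans (↭-map⁺ (deg G) (members-image I)) (↭-reflexive (begin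
      map (deg G) (map f (members H I)) ≡⟨ map-∘ (members H I) ⟨
      map (deg G ∘ f) (members H I)     ≡⟨ map-cong deg-induced (members H I) ⟩
      map (deg H) (members H I)         ∎))
      where open ≡-Reasoning

    w-image : ∀ I → w G (image I) ≡ w H I
    w-image I = sum-↭ (degrees-image I)

    δ-image : ∀ I → δ G (image I) ≡ δ H I
    δ-image I = minList-↭ (degrees-image I)

    isLargeIndep-image : ∀ I → T (isLargeIndep H I) → T (isLargeIndep G (image I))
    isLargeIndep-image I large with pw , δ<∣I∣ ← Equivalence.to (isLargeIndep⇔ H I) large =
      Equivalence.from (isLargeIndep⇔ G (image I))
        ( PairwiseNonadjacent-image I pw
        , subst₂ _<_ (≡-sym (δ-image I)) (≡-sym (length-members-image I)) δ<∣I∣ )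

    largeWeights-⊆ : largeWeights H ⊆ largeWeights G
    largeWeights-⊆ s∈ with I , large , refl ← ∈-largeWeights⁻ H s∈ =
      subst (_∈ largeWeights G) (w-image I) (∈-largeWeights⁺ G (image I) (isLargeIndep-image I large))

    σ*-≤-induced : σ* G ≤∞ σ* H
    σ*-≤-induced = minMaybe-mono-⊆ largeWeights-⊆

lemma1 : (G : Graph) (m : ℕ) (f : Fin m → Fin (n G)) (inj : Injective _≡_ _≡_ f) →
    IsComponent G m f → σ* G ≤∞ σ* (induced G m f inj)
lemma1 G m f inj component =
  Induced.σ*-≤-induced G m f inj (IsComponent⇒NeighbourClosed G m f component)
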